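{- Let $A$ be the adjacency matrix of a simple graph on $n$ vertices and let $C$ be the binary linear code generated by the $n\times 2n$ matrix $[I_n|A]$ over $\mathbb{F}_2$. Then $d(C)\le rk_2(A)+1$, where $rk_2(A)$ denotes the rank of $A$ as a matrix over $\mathbb{F}_2$.
   Context: For a matrix $G$ over $\mathbb{F}_2$, the code generated by $G$ is the $\mathbb{F}_2$-row space of $G$. The minimum distance $d(C)$ of a binary linear code $C$ is the minimum Hamming distance between distinct codewords, i.e. the minimum Hamming weight (number of nonzero coordinates) of a nonzero codeword. -}

module Defs where

open import Data.Bool using (Bool; true; false; _xor_; _∧_; if_then_else_)
open import Data.Nat using (ℕ; zero; suc; _+_; _≤_)
open import Data.Fin using (Fin; zero; suc; _≟_)
open import Data.Product using (Σ; ∃; _×_; _,_)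
open import Relation.Nullary using (¬_)
open import Relation.Nullary.Decidable using (isYes)
open import Relation.Binary.PropositionalEquality using (_≡_)
open import Data.Vec.Functional using (Vector; _++_)

-- F₂ is Bool with _xor_ as addition and _∧_ as multiplication.
F2Vec : ℕ → Set
F2Vec m = Vector Bool m

Matrix : ℕ → ℕ → Set
Matrix k m = Fin k → F2Vec m

zeroVec : ∀ {m} → F2Vec m
zeroVec _ = false

_+v_ : ∀ {m} → F2Vec m → F2Vec m → F2Vec m
(u +v v) j = u j xor v j

_·v_ : ∀ {m} → Bool → F2Vec m → F2Vec m
(c ·v v) j = c ∧ v j

_≈v_ : ∀ {m} → F2Vec m → F2Vec m → Set
u ≈v v = ∀ j → u j ≡ v j

linComb : ∀ {k m} → (Fin k → Bool) → (Fin k → F2Vec m) → F2Vec m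
linComb {zero}  c v = zeroVec
linComb {suc k} c v = (c zero ·v v zero) +v linComb (λ i → c (suc i)) (λ i → v (suc i))

weight : ∀ {m} → F2Vec m → ℕ
weight {zero}  v = 0
weight {suc m} v = (if v zero then 1 else 0) + weight (λ j → v (suc j))

InCode : ∀ {k m} → Matrix k m → F2Vec m → Set
InCode {k} G v = Σ (Fin k → Bool) λ c → linComb c G ≈v v

LinIndep : ∀ {r m} → (Fin r → F2Vec m) → Set
LinIndep {r} v = ∀ (c : Fin r → Bool) → linComb c v ≈v zeroVec → ∀ i → c i ≡ false

IsMinDistance : ∀ {k m} → Matrix k m → ℕ → Set
IsMinDistance G d =
  (Σ (F2Vec _) λ v → InCode G v × ¬ (v ≈v zeroVec) × weight v ≡ d)
  × (∀ v → InCode G v → ¬ (v ≈v zeroVec) → d ≤ weight v)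

IsRank₂ : ∀ {k m} → Matrix k m → ℕ → Set
IsRank₂ {m = m} A r =
  (Σ (Fin r → F2Vec m) λ v → (∀ i → InCode A (v i)) × LinIndep v)
  × (∀ s (v : Fin s → F2Vec m) → (∀ i → InCode A (v i)) → LinIndep v → s ≤ r)

IsSimpleAdj : ∀ {n} → Matrix n n → Set
IsSimpleAdj {n} A = (∀ i j → A i j ≡ A j i) × (∀ i → A i i ≡ false)

idMat : ∀ n → Matrix n n
idMat n i j = isYes (i ≟ j)

IA : ∀ {n} → Matrix n n → Matrix n (n + n)
IA {n} A i = idMat n i ++ A i

-- Summing the rows of [I | A] indexed by a nonempty set S of vertices gives the codeword
-- (1_S | Σ_{i ∈ S} A_i), of weight |S| + |Σ_{i ∈ S} A_i|. If r < n, any r + 1 rows of A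
-- lie in a row space of dimension r, so some nonempty S of size at most r + 1 has
-- Σ_{i ∈ S} A_i = 0, and the codeword has weight |S| ≤ r + 1. If r ≥ n, already a single
-- row of [I | A] has weight at most 1 + n ≤ r + 1.
module Submission where

open import Defs
open import Data.Bool using (Bool; true; false; _∧_)
open import Data.Bool.Properties using (xor-identityʳ; ∧-zeroʳ; ∧-identityʳ) renaming (_≟_ to _≟ᵇ_)
open import Data.Empty using (⊥-elim)
open import Data.Fin using (Fin; zero; suc; _↑ˡ_; splitAt)
open import Data.Fin.Properties using (all?; any?) renaming (_≟_ to _≟ᶠ_)
open import Data.Fin.Subset.Properties using (anySubset?)
open import Data.Nat using (ℕ; zero; suc; _+_; _≤_; _<_; z≤n; s≤s)
open import Data.Nat.Properties
  using (≤-trans; n≤1+n; m≤n⇒m<n∨m≡n; <-irrefl; _<?_; ≮⇒≥; +-comm; +-identityʳ; +-monoʳ-≤; module ≤-Reasoning)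
open import Data.Product using (∃; _×_; _,_)
open import Data.Sum using (_⊎_; inj₁; inj₂; [_,_]′)
open import Data.Vec using (lookup; tabulate)
open import Data.Vec.Properties using (lookup∘tabulate)
open import Data.Vec.Functional using (_++_; _∷_)
open import Data.Vec.Functional.Properties using (lookup-++ˡ)
open import Function using (case_of_)
open import Relation.Nullary using (¬_; Dec; yes; no)
open import Relation.Nullary.Decidable using (_×-dec_)
open import Relation.Binary.PropositionalEquality
  using (_≡_; refl; sym; trans; cong; subst; module ≡-Reasoning)

linComb-cong-coeffs : ∀ {k m} (c c′ : Fin k → Bool) (v : Fin k → F2Vec m) →
  (∀ i → c i ≡ c′ i) → linComb c v ≈v linComb c′ v
linComb-cong-coeffs {zero}  c c′ v c≡c′ j = refl
linComb-cong-coeffs {suc k} c c′ v c≡c′ j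
  rewrite c≡c′ zero
        | linComb-cong-coeffs (λ i → c (suc i)) (λ i → c′ (suc i)) (λ i → v (suc i)) (λ i → c≡c′ (suc i)) j
  = refl

linComb-cong-column : ∀ {k m m′} (c : Fin k → Bool) (v : Fin k → F2Vec m) (w : Fin k → F2Vec m′) j j′ →
  (∀ l → v l j ≡ w l j′) → linComb c v j ≡ linComb c w j′
linComb-cong-column {zero}  c v w j j′ v≡w = refl
linComb-cong-column {suc k} c v w j j′ v≡w
  rewrite v≡w zero
        | linComb-cong-column (λ l → c (suc l)) (λ l → v (suc l)) (λ l → w (suc l)) j j′ (λ l → v≡w (suc l))
  = refl

linComb-zero-column : ∀ {k m} (c : Fin k → Bool) (v : Fin k → F2Vec m) j →
  (∀ l → v l j ≡ false) → linComb c v j ≡ false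
linComb-zero-column {zero}  c v j v≡0 = refl
linComb-zero-column {suc k} c v j v≡0
  rewrite v≡0 zero
        | linComb-zero-column (λ l → c (suc l)) (λ l → v (suc l)) j (λ l → v≡0 (suc l))
        | ∧-zeroʳ (c zero)
  = refl

linComb-zero-coeffs : ∀ {k m} (v : Fin k → F2Vec m) → linComb (λ _ → false) v ≈v zeroVec
linComb-zero-coeffs {zero}  v j = refl
linComb-zero-coeffs {suc k} v j = linComb-zero-coeffs (λ l → v (suc l)) j

linComb-++ : ∀ {k m n} (c : Fin k → Bool) (u : Fin k → F2Vec m) (w : Fin k → F2Vec n) →
  linComb c (λ l → u l ++ w l) ≈v (linComb c u ++ linComb c w)
linComb-++ {m = m} c u w j with splitAt m j in eq
... | inj₁ a = linComb-cong-column c _ u j a (λ l → cong [ u l , w l ]′ eq)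
... | inj₂ b = linComb-cong-column c _ w j b (λ l → cong [ u l , w l ]′ eq)

idMat-suc : ∀ {n} (i j : Fin n) → idMat (suc n) (suc i) (suc j) ≡ idMat n i j
idMat-suc i j with i ≟ᶠ j
... | yes _ = refl
... | no  _ = refl

linComb-unit : ∀ {k m} (v : Fin k → F2Vec m) i → linComb (idMat k i) v ≈v v i
linComb-unit {suc k} v zero j
  rewrite linComb-zero-coeffs (λ l → v (suc l)) j = xor-identityʳ (v zero j)
linComb-unit {suc k} v (suc i) j = begin
  linComb (λ l → idMat (suc k) (suc i) (suc l)) (λ l → v (suc l)) j
    ≡⟨ linComb-cong-coeffs _ (idMat k i) _ (idMat-suc i) j ⟩
  linComb (idMat k i) (λ l → v (suc l)) j
    ≡⟨ linComb-unit (λ l → v (suc l)) i j ⟩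
  v (suc i) j ∎
  where open ≡-Reasoning

row-inCode : ∀ {k m} (G : Matrix k m) i → InCode G (G i)
row-inCode {k} G i = idMat k i , linComb-unit G i

linComb-idMat : ∀ {n} (c : Fin n → Bool) → linComb c (idMat n) ≈v c
linComb-idMat {suc n} c zero
  rewrite linComb-zero-column (λ i → c (suc i)) (λ i → idMat (suc n) (suc i)) zero (λ _ → refl)
  = trans (xor-identityʳ (c zero ∧ true)) (∧-identityʳ (c zero))
linComb-idMat {suc n} c (suc j) rewrite ∧-zeroʳ (c zero) = begin
  linComb (λ i → c (suc i)) (λ i → idMat (suc n) (suc i)) (suc j)
    ≡⟨ linComb-cong-column _ _ (idMat n) (suc j) j (λ i → idMat-suc i j) ⟩
  linComb (λ i → c (suc i)) (idMat n) j
    ≡⟨ linComb-idMat (λ i → c (suc i)) j ⟩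
  c (suc j) ∎
  where open ≡-Reasoning

weight-cong : ∀ {m} {u w : F2Vec m} → u ≈v w → weight u ≡ weight w
weight-cong {zero}  u≈w = refl
weight-cong {suc m} u≈w rewrite u≈w zero | weight-cong {m} (λ j → u≈w (suc j)) = refl

weight-zeroVec : ∀ {m} → weight (zeroVec {m}) ≡ 0
weight-zeroVec {zero}  = refl
weight-zeroVec {suc m} = weight-zeroVec {m}

weight-≤-length : ∀ {m} (u : F2Vec m) → weight u ≤ m
weight-≤-length {zero}  u = z≤n
weight-≤-length {suc m} u with u zero
... | true  = s≤s (weight-≤-length (λ j → u (suc j)))
... | false = ≤-trans (weight-≤-length (λ j → u (suc j))) (n≤1+n m)

++-tail : ∀ {m n} (u : F2Vec (suc m)) (w : F2Vec n) →
  (λ j → (u ++ w) (suc j)) ≈v ((λ j → u (suc j)) ++ w)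
++-tail {m} u w j with splitAt m j
... | inj₁ _ = refl
... | inj₂ _ = refl

weight-++ : ∀ {m n} (u : F2Vec m) (w : F2Vec n) → weight (u ++ w) ≡ weight u + weight w
weight-++ {zero}  u w = refl
weight-++ {suc m} u w
  rewrite weight-cong (++-tail u w) | weight-++ (λ j → u (suc j)) w with u zero
... | true  = refl
... | false = refl

weight-linComb-IA : ∀ {n} (A : Matrix n n) (c : Fin n → Bool) →
  weight (linComb c (IA A)) ≡ weight c + weight (linComb c A)
weight-linComb-IA {n} A c = begin
  weight (linComb c (IA A))                            ≡⟨ weight-cong (linComb-++ c (idMat n) A) ⟩
  weight (linComb c (idMat n) ++ linComb c A)          ≡⟨ weight-++ (linComb c (idMat n)) (linComb c A) ⟩
  weight (linComb c (idMat n)) + weight (linComb c A)  ≡⟨ cong (_+ weight (linComb c A)) (weight-cong (linComb-idMat c)) ⟩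
  weight c + weight (linComb c A)                      ∎
  where open ≡-Reasoning

linComb-IA-nonzero : ∀ {n} (A : Matrix n n) (c : Fin n → Bool) i → c i ≡ true →
  ¬ (linComb c (IA A) ≈v zeroVec)
linComb-IA-nonzero {n} A c i cᵢ≡true v≈0 = case trans (sym cᵢ≡true) cᵢ≡false of λ ()
  where
  open ≡-Reasoning
  cᵢ≡false : c i ≡ false
  cᵢ≡false = begin
    c i                                            ≡⟨ linComb-idMat c i ⟨
    linComb c (idMat n) i                          ≡⟨ lookup-++ˡ (linComb c (idMat n)) (linComb c A) i ⟨
    (linComb c (idMat n) ++ linComb c A) (i ↑ˡ n)  ≡⟨ linComb-++ c (idMat n) A (i ↑ˡ n) ⟨
    linComb c (IA A) (i ↑ˡ n)                      ≡⟨ v≈0 (i ↑ˡ n) ⟩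
    false                                          ∎

minDistance-IA-≤ : ∀ {n} (A : Matrix n n) {d} → IsMinDistance (IA A) d →
  ∀ (c : Fin n → Bool) i → c i ≡ true → d ≤ weight c + weight (linComb c A)
minDistance-IA-≤ A (_ , minimal) c i cᵢ≡true =
  subst (_ ≤_) (weight-linComb-IA A c)
    (minimal (linComb c (IA A)) (c , λ _ → refl) (linComb-IA-nonzero A c i cᵢ≡true))

Dependency : ∀ {k m} → (Fin k → F2Vec m) → (Fin k → Bool) → Set
Dependency v c = (linComb c v ≈v zeroVec) × ∃ λ i → c i ≡ true

dependency? : ∀ {k m} (v : Fin k → F2Vec m) c → Dec (Dependency v c)
dependency? v c = all? (λ j → linComb c v j ≟ᵇ false) ×-dec any? (λ i → c i ≟ᵇ true)

-- Exhaustive search over the 2^k coefficient vectors, enumerated as subsets of Fin k.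
linIndep-or-dependency : ∀ {k m} (v : Fin k → F2Vec m) → LinIndep v ⊎ ∃ (Dependency v)
linIndep-or-dependency v with anySubset? (λ p → dependency? v (lookup p))
... | yes (p , dep) = inj₂ (lookup p , dep)
... | no ¬dep       = inj₁ independent
  where
  independent : LinIndep v
  independent c c·v≈0 i with c i in cᵢ
  ... | false = refl
  ... | true  = ⊥-elim (¬dep (tabulate c , tabulated-dep))
    where
    tabulated-dep : Dependency v (lookup (tabulate c))
    tabulated-dep = (λ j → trans (linComb-cong-coeffs _ c v (lookup∘tabulate c) j) (c·v≈0 j))
                  , i , trans (lookup∘tabulate c i) cᵢ

DimAtMost : ∀ {k m} → Matrix k m → ℕ → Set
DimAtMost {m = m} G r = ∀ s (v : Fin s → F2Vec m) → (∀ i → InCode G (v i)) → LinIndep v → s ≤ r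

short-dependency : ∀ {k m s r} (G : Matrix k m) → DimAtMost G r →
  (v : Fin s → F2Vec m) → (∀ i → InCode G (v i)) → r < s →
  ∃ λ c → Dependency v c × weight c ≤ suc r
short-dependency {s = suc s} G dim v v∈G (s≤s r≤s) with m≤n⇒m<n∨m≡n r≤s
... | inj₁ r<s with short-dependency G dim (λ i → v (suc i)) (λ i → v∈G (suc i)) r<s
...   | c , (c·v≈0 , i , cᵢ) , |c|≤1+r = (false ∷ c) , (c·v≈0 , suc i , cᵢ) , |c|≤1+r
short-dependency {s = suc s} G dim v v∈G _ | inj₂ refl with linIndep-or-dependency v
... | inj₁ independent = ⊥-elim (<-irrefl refl (dim (suc s) v v∈G independent))
... | inj₂ (c , dep)   = c , dep , weight-≤-length c

mainTheorem1 : ∀ (n : ℕ) (A : Matrix n n) → IsSimpleAdj A →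
    ∀ (r d : ℕ) → IsRank₂ A r → IsMinDistance (IA A) d → d ≤ r + 1
mainTheorem1 zero A _ r d _ ((_ , _ , v≉0 , _) , _) = ⊥-elim (v≉0 λ ())
mainTheorem1 n@(suc n′) A _ r d (_ , dim) min-d with r <? n
... | yes r<n with short-dependency A dim A (row-inCode A) r<n
...   | c , (c·A≈0 , i , cᵢ) , |c|≤1+r = begin
  d                                ≤⟨ minDistance-IA-≤ A min-d c i cᵢ ⟩
  weight c + weight (linComb c A)  ≡⟨ cong (weight c +_) (trans (weight-cong c·A≈0) (weight-zeroVec {n})) ⟩
  weight c + 0                     ≡⟨ +-identityʳ (weight c) ⟩
  weight c                         ≤⟨ |c|≤1+r ⟩
  suc r                            ≡⟨ +-comm 1 r ⟩
  r + 1                            ∎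
  where open ≤-Reasoning
mainTheorem1 n@(suc n′) A _ r d _ min-d | no r≮n = begin
  d                                                  ≤⟨ minDistance-IA-≤ A min-d (idMat n zero) zero refl ⟩
  weight (idMat n zero) + weight (linComb (idMat n zero) A)
                                                     ≡⟨ cong (weight (idMat n zero) +_) (weight-cong (linComb-unit A zero)) ⟩
  weight (idMat n zero) + weight (A zero)            ≡⟨ cong (_+ weight (A zero)) (cong suc (weight-zeroVec {n′})) ⟩
  1 + weight (A zero)                                ≤⟨ +-monoʳ-≤ 1 (≤-trans (weight-≤-length (A zero)) (≮⇒≥ r≮n)) ⟩
  1 + r                                              ≡⟨ +-comm 1 r ⟩
  r + 1                                              ∎
  where open ≤-Reasoning
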